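{- Let $\frac mn$ be a positive irreducible fraction and let $\Omega$ be a finite set of positive integers. Then there are infinitely many ways to choose a nonnegative integer $t$, an integer $x$ and positive integers $b_1,\dots,b_{t+1}$ such that \[ \frac mn=\frac1{b_1}+\cdots+\frac1{b_t}+\frac{x}{b_{t+1}}+\frac1{n b_1\cdots b_t b_{t+1}} \] is a faithful decomposition of $\frac mn$, where for each $1\le i\le t+1$, $b_i$ is coprime to every element of $\{b_j\}_{j\ne i}\cup\Omega$.
   Context: A (fraction) decomposition of a positive rational $\frac mn$ is an expression $\frac mn=\frac{a_1}{b_1}+\cdots+\frac{a_k}{b_k}$ where $a_1,\dots,a_k$ are positive integers and $b_1,\dots,b_k$ are pairwise distinct positive integers; $k$ is its length. For a positive irreducible fraction $u=\frac mn$, such a decomposition is called faithful if for all integers $x_1,\dots,x_k$ with $0\le x_i\le a_i$, the number $v=\sum_{i=1}^k \frac{x_i}{b_i}$ does not lie in $\frac1n\mathbb Z$ unless $v=u$ or $v=0$. -}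

module Defs where

open import Data.Nat using (ℕ; zero; suc; _*_; _≤_; _<_)
open import Data.Nat.Coprimality using (Coprime)
open import Data.Integer using (ℤ; +_)
open import Data.Rational using (ℚ; 0ℚ; _+_; _/_)
open import Data.Fin using (Fin)
open import Data.Vec using (Vec; toList; lookup; _∷ʳ_)
open import Data.List using (List; []; _∷_; map; _++_; zip)
open import Data.Nat.ListAction using (product)
open import Data.List.Relation.Unary.All using (All)
open import Data.List.Relation.Unary.Unique.Propositional using (Unique)
open import Data.List.Relation.Binary.Pointwise using (Pointwise)
open import Data.List.Membership.Propositional using (_∈_)
open import Data.Product using (Σ; ∃; _×_; _,_; proj₁; proj₂)
open import Data.Sum using (_⊎_)
open import Relation.Binary.PropositionalEquality using (_≡_; _≢_)

-- The fraction a / b as a rational.  Only ever used with b > 0 (this is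
-- required explicitly in IsDecomposition); the b = 0 case is a dummy value.
frac : ℤ → ℕ → ℚ
frac a zero    = 0ℚ
frac a (suc b) = a / suc b

termsSum : List (ℕ × ℕ) → ℚ
termsSum []             = 0ℚ
termsSum ((a , b) ∷ ds) = frac (+ a) b + termsSum ds

IsDecomposition : ℚ → List (ℕ × ℕ) → Set
IsDecomposition u d =
  All (λ p → 0 < proj₁ p × 0 < proj₂ p) d
  × Unique (map proj₂ d)
  × termsSum d ≡ u

IsFaithful : (m n : ℕ) → List (ℕ × ℕ) → Set
IsFaithful m n d =
  IsDecomposition (frac (+ m) n) d
  × (∀ (xs : List ℕ) → Pointwise _≤_ xs (map proj₁ d) →
       let v = termsSum (zip xs (map proj₂ d)) in
       (∃ λ (z : ℤ) → v ≡ frac z n) → v ≡ frac (+ m) n ⊎ v ≡ 0ℚ)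

-- A choice (t , x , (b_1,...,b_t) , b_{t+1}).
Choice : Set
Choice = Σ ℕ (λ t → ℕ × Vec ℕ t × ℕ)

choiceTerms : ℕ → Choice → List (ℕ × ℕ)
choiceTerms n (t , x , bs , c) =
  map (λ b → (1 , b)) (toList bs)
  ++ (x , c) ∷ (1 , n * product (toList bs) * c) ∷ []

allB : (τ : Choice) → Vec ℕ (suc (proj₁ τ))
allB (t , x , bs , c) = bs ∷ʳ c

ValidChoice : (m n : ℕ) (Ω : List ℕ) → Choice → Set
ValidChoice m n Ω τ =
  (∀ i → 0 < lookup (allB τ) i)
  × IsFaithful m n (choiceTerms n τ)
  × (∀ i j → i ≢ j → Coprime (lookup (allB τ) i) (lookup (allB τ) j))
  × (∀ i ω → ω ∈ Ω → Coprime (lookup (allB τ) i) ω)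

module Submission where

-- Over the primes p ∤ K the sum Σ 1/p diverges, by an elementary count: the n ≤ (2K)²
-- without a prime factor p ∤ K have the form s r² with s ∣ K and r ≤ 2K, so they are
-- at most half of all n ≤ (2K)².  Hence there are pairwise coprime b₁, …, b_t > 1,
-- coprime to n ∏Ω, with Σ 1/bᵢ < m/n < Σ 1/bᵢ + 1.  With B = ∏ bᵢ this leaves
-- m/n − Σ 1/bᵢ = M/(nB) with gcd(M, nB) = 1, and every solution of M c = nB x + 1
-- gives m/n = Σ 1/bᵢ + x/c + 1/(nBc); such c exist arbitrarily large and coprime
-- to ∏Ω.  Faithfulness: if a subsum lies in (1/n)ℤ, clearing denominators and
-- reducing modulo c and modulo the pairwise coprime bᵢ forces its coefficients to
-- be all zero or all maximal.

open import Defs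
open import Data.Nat
open import Data.Nat.Properties
open import Data.Nat.Divisibility
open import Data.Nat.Coprimality using (Coprime; coprime-divisor; coprime-Bézout; 1-coprimeTo; prime⇒coprime)
  renaming (sym to coprime-sym)
open import Data.Nat.GCD using (module Bézout)
open import Data.Nat.DivMod using (_%_; _/_; m≡m%n+[m/n]*n; [m+kn]%n≡m%n; m<n⇒m%n≡m)
open import Data.Nat.Primality.Factorisation using (factorise; PrimeFactorisation)
open import Data.Nat.Primality
  using (Prime; prime⇒irreducible; prime⇒nonTrivial; prime⇒nonZero; euclidsLemma; prime?)
open import Data.Nat.ListAction using (sum; product)
open import Data.Nat.ListAction.Properties using (product-++; ∈⇒∣product; product≢0; ∈⇒≤product)
open import Data.Nat.Tactic.RingSolver using (solve-∀)
open import Algebra.Properties.CommutativeSemigroup +-commutativeSemigroup using (interchange)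
open import Data.List using (List; []; _∷_; _++_; map; length; filter; applyDownFrom; zip)
open import Data.List.Properties
  using (length-applyDownFrom; map-cong; map-∘; map-id; map-++; ++-assoc; length-map)
open import Data.List.Relation.Unary.All as All using (All; []; _∷_)
import Data.List.Relation.Unary.All.Properties as AllP
open AllP using (all-filter)
open import Data.List.Relation.Unary.AllPairs as AllPairs using (AllPairs; []; _∷_)
import Data.List.Relation.Unary.AllPairs.Properties as AllPairsP
open import Data.List.Relation.Unary.Any using (here; there; any?)
open import Data.List.Membership.Propositional using (_∈_; _∉_; find; lose)
open import Data.List.Membership.Propositional.Properties
  using (∈-applyDownFrom⁺; ∈-applyDownFrom⁻; ∈-filter⁺)
open import Data.List.Relation.Binary.Pointwise using (Pointwise; []; _∷_; Pointwise-length)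
open import Data.Integer as ℤ using (ℤ)
import Data.Integer.Properties as ℤ
open import Data.Rational as ℚ using (ℚ; 0ℚ; fromℚᵘ)
open import Data.Rational.Properties
  using (fromℚᵘ-cong; /-injective-≃; toℚᵘ-homo-+; fromℚᵘ-toℚᵘ; toℚᵘ-fromℚᵘ)
import Data.Rational.Properties as ℚ
open import Data.Rational.Unnormalised as ℚᵘ using (mkℚᵘ; *≡*)
import Data.Rational.Unnormalised.Properties as ℚᵘ
open import Data.Vec using (Vec; toList; fromList; lookup; _∷ʳ_; []; _∷_)
open import Data.Vec.Properties using (toList-∷ʳ; toList∘fromList)
open import Data.Fin using (zero; suc)
open import Data.Product using (∃; ∃₂; _×_; _,_; proj₁; proj₂)
open import Data.Sum as Sum using (_⊎_; inj₁; inj₂)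
open import Data.Empty using (⊥-elim)
open import Function using (_∘_; it)
open import Relation.Nullary using (¬_; Dec; yes; no; ¬?; _×-dec_)
open import Relation.Binary.PropositionalEquality

private
  variable
    a b c d k m n K : ℕ
    bs : List ℕ

-- Coprimality and divisibility

coprime-∣ˡ : d ∣ a → Coprime a b → Coprime d b
coprime-∣ˡ d∣a a⊥b (e∣d , e∣b) = a⊥b (∣-trans e∣d d∣a , e∣b)

coprime-∣ʳ : d ∣ b → Coprime a b → Coprime a d
coprime-∣ʳ d∣b a⊥b (e∣a , e∣d) = a⊥b (e∣a , ∣-trans e∣d d∣b)

coprime-*ʳ : Coprime a b → Coprime a c → Coprime a (b * c)
coprime-*ʳ a⊥b a⊥c (d∣a , d∣bc) = a⊥c (d∣a , coprime-divisor (coprime-∣ˡ d∣a a⊥b) d∣bc)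

coprime-productʳ : All (Coprime a) bs → Coprime a (product bs)
coprime-productʳ {a} []           = coprime-sym (1-coprimeTo a)
coprime-productʳ     (a⊥b ∷ a⊥bs) = coprime-*ʳ a⊥b (coprime-productʳ a⊥bs)

coprime-+*ˡ : ∀ k → Coprime a b → Coprime (a + b * k) b
coprime-+*ˡ {a} k a⊥b {e} (d∣a+bk , d∣b) =
  a⊥b (∣m+n∣m⇒∣n (subst (e ∣_) (+-comm a _) d∣a+bk) (∣m⇒∣m*n k d∣b) , d∣b)

coprime-∣⇒≡1 : Coprime a b → a ∣ b → a ≡ 1
coprime-∣⇒≡1 a⊥b a∣b = a⊥b (∣-refl , a∣b)

*+1⇒coprime : a * b ≡ c * d + 1 → Coprime b c
*+1⇒coprime {a} {d = d} eq {e} (e∣b , e∣c) =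
  ∣1⇒≡1 (∣m+n∣m⇒∣n (subst (e ∣_) eq (∣n⇒∣m*n a e∣b)) (∣m⇒∣m*n d e∣c))

coprime-∣⇒*∣ : Coprime a b → a ∣ K → b ∣ K → a * b ∣ K
coprime-∣⇒*∣ {a} {b} a⊥b a∣K (divides q refl)
  with coprime-divisor a⊥b (subst (a ∣_) (*-comm q b) a∣K)
... | divides r refl = divides r (*-assoc r a b)

prime-∤⇒coprime : ∀ {p} → Prime p → ¬ p ∣ a → Coprime p a
prime-∤⇒coprime p-prime p∤a (d∣p , d∣a) with prime⇒irreducible p-prime d∣p
... | inj₁ d≡1  = d≡1
... | inj₂ refl = ⊥-elim (p∤a d∣a)

≥2⇒≢1 : 2 ≤ a → a ≢ 1
≥2⇒≢1 (s≤s ()) refl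

coprime-≥2⇒≢ : 2 ≤ a → Coprime a b → a ≢ b
coprime-≥2⇒≢ a≥2 a⊥b refl = ≥2⇒≢1 a≥2 (coprime-∣⇒≡1 a⊥b ∣-refl)

≥2⇒nonZero : 2 ≤ a → NonZero a
≥2⇒nonZero (s≤s _) = _

∣<⇒≡0 : d ∣ a → a < d → a ≡ 0
∣<⇒≡0 {a = zero}  _   _   = refl
∣<⇒≡0 {a = suc _} d∣a a<d = ⊥-elim (>⇒∤ a<d d∣a)

coprime-∣*+1⇒≡ : ∀ {N u v} → Coprime c N → c ∣ N * u + 1 → c ∣ N * v + 1 →
  u ≤ v → v < c → u ≡ v
coprime-∣*+1⇒≡ {c} {N} {u} {v} c⊥N c∣Nu+1 c∣Nv+1 u≤v v<c = begin
  u         ≡⟨ +-identityʳ u ⟨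
  u + 0     ≡⟨ cong (u +_) gap≡0 ⟨
  u + gap   ≡⟨ m+[n∸m]≡n u≤v ⟩
  v         ∎
  where
  open ≡-Reasoning
  gap = v ∸ u
  lemma : ∀ N u g → N * (u + g) + 1 ≡ N * u + 1 + N * g
  lemma = solve-∀
  c∣N*gap : c ∣ N * gap
  c∣N*gap = ∣m+n∣m⇒∣n (subst (c ∣_) (trans (cong (λ z → N * z + 1) (sym (m+[n∸m]≡n u≤v)))
                                            (lemma N u gap)) c∣Nv+1)
                      c∣Nu+1
  gap≡0 : gap ≡ 0
  gap≡0 = ∣<⇒≡0 (coprime-divisor c⊥N c∣N*gap) (≤-<-trans (m∸n≤m v u) v<c)

%≡1⇒≡*+1 : ∀ {a Q} .{{_ : NonZero Q}} → a % Q ≡ 1 → a ≡ Q * (a / Q) + 1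
%≡1⇒≡*+1 {a} {Q} a%Q≡1 = trans (m≡m%n+[m/n]*n a Q) (trans (cong (_+ a / Q * Q) a%Q≡1)
                                  (trans (+-comm 1 _) (cong (_+ 1) (*-comm (a / Q) Q))))

modularInverse : ∀ {M Q} → 2 ≤ Q → Coprime M Q → ∃₂ λ c k → M * c ≡ Q * k + 1
modularInverse {M} {Q@(suc q)} Q≥2 M⊥Q with coprime-Bézout M⊥Q
... | Bézout.+- x y eq = x , _ , %≡1⇒≡*+1 (begin
  M * x % Q               ≡⟨ cong (_% Q) (trans (*-comm M x) (sym eq)) ⟩
  (1 + y * Q) % Q         ≡⟨ [m+kn]%n≡m%n 1 y Q ⟩
  1 % Q                   ≡⟨ m<n⇒m%n≡m Q≥2 ⟩
  1                       ∎)
  where open ≡-Reasoning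
-- Here M x ≡ -1 (mod Q), so M (Q - 1) x ≡ 1.
... | Bézout.-+ x y eq = q * x , _ , %≡1⇒≡*+1 (begin
  M * (q * x) % Q                   ≡⟨ sym ([m+kn]%n≡m%n (M * (q * x)) y Q) ⟩
  (M * (q * x) + y * Q) % Q         ≡⟨ cong (λ z → (M * (q * x) + z) % Q) (sym eq) ⟩
  (M * (q * x) + (1 + x * M)) % Q   ≡⟨ cong (_% Q) (lemma M q x) ⟩
  (1 + x * M * Q) % Q               ≡⟨ [m+kn]%n≡m%n 1 (x * M) Q ⟩
  1 % Q                             ≡⟨ m<n⇒m%n≡m Q≥2 ⟩
  1                                 ∎)
  where
  open ≡-Reasoning
  lemma : ∀ M q x → M * (q * x) + (1 + x * M) ≡ 1 + x * M * suc q
  lemma = solve-∀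

coprimeInProgression-product : ∀ {a q} ps → All Prime ps → Coprime a q →
  ∃ λ k → Coprime (a + q * k) (product ps)
coprimeInProgression-product {a} [] [] a⊥q = 0 , coprime-sym (1-coprimeTo _)
coprimeInProgression-product {a} {q} (p ∷ ps) (p-prime ∷ ps-prime) a⊥q
  with k , c⊥P ← coprimeInProgression-product ps ps-prime a⊥q
  with p ∣? a + q * k
... | no p∤c  = k , coprime-*ʳ (coprime-sym (prime-∤⇒coprime p-prime p∤c)) c⊥P
-- p ∤ q P, so passing from k to k + P keeps a + q k coprime to P and makes it coprime to p.
... | yes p∣c = k + P , subst (λ z → Coprime z (p * P)) (lemma a q k P)
                          (coprime-*ʳ (coprime-sym (prime-∤⇒coprime p-prime p∤c′)) (coprime-+*ˡ q c⊥P))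
  where
  P = product ps
  t = a + q * k
  p≢1 : p ≢ 1
  p≢1 = nonTrivial⇒≢1 {{prime⇒nonTrivial p-prime}}
  lemma : ∀ a q k P → a + q * k + P * q ≡ a + q * (k + P)
  lemma = solve-∀
  p∤c′ : ¬ p ∣ t + P * q
  p∤c′ p∣c′ with euclidsLemma P q p-prime (∣m+n∣m⇒∣n p∣c′ p∣c)
  ... | inj₁ p∣P = p≢1 (c⊥P (p∣c , p∣P))
  ... | inj₂ p∣q =
    p≢1 (a⊥q (∣m+n∣m⇒∣n (subst (p ∣_) (+-comm a _) p∣c) (∣m⇒∣m*n k p∣q) , p∣q))

coprimeInProgression : ∀ {a q} W → .{{NonZero W}} → Coprime a q → ∃ λ k → Coprime (a + q * k) W
coprimeInProgression W a⊥q =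
  let k , c⊥W = coprimeInProgression-product factors factorsPrime a⊥q
  in  k , subst (Coprime _) (sym isFactorisation) c⊥W
  where open PrimeFactorisation (factorise W)

largeInverse : ∀ {M Q} W β → .{{NonZero W}} → 2 ≤ Q → Coprime M Q →
  ∃₂ λ c x → M * c ≡ Q * x + 1 × β < c × Coprime c W
largeInverse {M} {Q} W β Q≥2 M⊥Q
  with c₀ , k₀ , Mc₀≡ ← modularInverse Q≥2 M⊥Q
  with k , c⊥W ← coprimeInProgression {c₀ + Q * suc β} {Q} W
                    (coprime-+*ˡ (suc β) (*+1⇒coprime {M} Mc₀≡))
  = c₀ + Q * suc β + Q * k , k₀ + M * (suc β + k) , Mc≡ , β<c , c⊥W
  where
  open ≤-Reasoning
  lemma : ∀ M c₀ Q b k → M * (c₀ + Q * b + Q * k) ≡ M * c₀ + Q * (M * (b + k))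
  lemma = solve-∀
  Mc≡ : M * (c₀ + Q * suc β + Q * k) ≡ Q * (k₀ + M * (suc β + k)) + 1
  Mc≡ = begin-equality
    M * (c₀ + Q * suc β + Q * k)          ≡⟨ lemma M c₀ Q (suc β) k ⟩
    M * c₀ + Q * (M * (suc β + k))        ≡⟨ cong (_+ Q * (M * (suc β + k))) Mc₀≡ ⟩
    Q * k₀ + 1 + Q * (M * (suc β + k))    ≡⟨ lemma₂ Q k₀ (M * (suc β + k)) ⟩
    Q * (k₀ + M * (suc β + k)) + 1        ∎
    where
    lemma₂ : ∀ Q k u → Q * k + 1 + Q * u ≡ Q * (k + u) + 1
    lemma₂ = solve-∀
  β<c : β < c₀ + Q * suc β + Q * k
  β<c = begin
    suc β                                 ≤⟨ m≤n*m (suc β) Q {{≥2⇒nonZero Q≥2}} ⟩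
    Q * suc β                             ≤⟨ m≤n+m _ c₀ ⟩
    c₀ + Q * suc β                        ≤⟨ m≤m+n _ (Q * k) ⟩
    c₀ + Q * suc β + Q * k                ∎

-- Sums of reciprocals

-- Σᵢ yᵢ / bᵢ = weightedNumerator ys bs / product bs.
weightedNumerator : List ℕ → List ℕ → ℕ
weightedNumerator (y ∷ ys) (b ∷ bs) = y * product bs + b * weightedNumerator ys bs
weightedNumerator _        _        = 0

ones : List ℕ → List ℕ
ones = map (λ _ → 1)

reciprocalNumerator : List ℕ → ℕ
reciprocalNumerator bs = weightedNumerator (ones bs) bs

reciprocalNumerator-++ : ∀ bs cs → reciprocalNumerator (bs ++ cs) ≡
  reciprocalNumerator bs * product cs + product bs * reciprocalNumerator cs
reciprocalNumerator-++ []       cs = sym (+-identityʳ _)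
reciprocalNumerator-++ (b ∷ bs) cs
  rewrite product-++ bs cs | reciprocalNumerator-++ bs cs =
    lemma b (product bs) (product cs) (reciprocalNumerator bs) (reciprocalNumerator cs)
  where
  lemma : ∀ b p q r s → 1 * (p * q) + b * (r * q + p * s) ≡ (1 * p + b * r) * q + b * p * s
  lemma = solve-∀

reciprocalNumerator-coprime : AllPairs Coprime bs → Coprime (reciprocalNumerator bs) (product bs)
reciprocalNumerator-coprime {[]}     []             = coprime-sym (1-coprimeTo 0)
reciprocalNumerator-coprime {b ∷ bs} (b⊥bs ∷ bs⊥) = coprime-*ʳ r⊥b r⊥P
  where
  P = product bs
  R = reciprocalNumerator bs
  b⊥P : Coprime b P
  b⊥P = coprime-productʳ b⊥bs
  r⊥b : Coprime (1 * P + b * R) b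
  r⊥b = coprime-+*ˡ R (subst (λ z → Coprime z b) (sym (*-identityˡ P)) (coprime-sym b⊥P))
  r⊥P : Coprime (1 * P + b * R) P
  r⊥P = subst (λ z → Coprime z P) (trans (+-comm (b * R) (P * 1)) (cong (_+ b * R) (*-comm P 1)))
          (coprime-+*ˡ 1 (coprime-sym (coprime-*ʳ (coprime-sym b⊥P)
                                                 (coprime-sym (reciprocalNumerator-coprime bs⊥)))))

-- The two integrality lemmas behind faithfulness: a 0/1-subsum of the
-- reciprocals of pairwise coprime bᵢ > 1, scaled by some A, lies in (1/A)ℤ
-- resp. (1/A)ℤ - 1/(A ∏ bᵢ) only if it is empty resp. full.
∣*weightedNumerator⇒≡0 : ∀ {A ys} → Pointwise _≤_ ys (ones bs) → All (2 ≤_) bs →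
  AllPairs Coprime bs → All (λ b → Coprime b A) bs →
  product bs ∣ A * weightedNumerator ys bs → weightedNumerator ys bs ≡ 0
∣*weightedNumerator⇒≡0 [] [] [] [] _ = refl
∣*weightedNumerator⇒≡0 {b ∷ bs} {A} {0 ∷ ys}
  (_ ∷ ys≤1) (b≥2 ∷ bs≥2) (_ ∷ bs⊥) (_ ∷ bs⊥A) ∣w =
  trans (cong (b *_) (∣*weightedNumerator⇒≡0 ys≤1 bs≥2 bs⊥ bs⊥A B∣Aw)) (*-zeroʳ b)
  where
  lemma : ∀ A b P w → A * (0 * P + b * w) ≡ b * (A * w)
  lemma = solve-∀
  B∣Aw : product bs ∣ A * weightedNumerator ys bs
  B∣Aw = *-cancelˡ-∣ b {{≥2⇒nonZero b≥2}} (subst (b * product bs ∣_) (lemma A b (product bs) _) ∣w)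
∣*weightedNumerator⇒≡0 {b ∷ bs} {A} {1 ∷ ys}
  (_ ∷ ys≤1) (b≥2 ∷ _) (b⊥bs ∷ _) (b⊥A ∷ _) ∣w =
  ⊥-elim (≥2⇒≢1 b≥2 (coprime-∣⇒≡1 (coprime-*ʳ b⊥A (coprime-productʳ b⊥bs)) b∣AP))
  where
  lemma : ∀ A b P w → A * (1 * P + b * w) ≡ b * (A * w) + A * P
  lemma = solve-∀
  b∣AP : b ∣ A * product bs
  b∣AP = ∣m+n∣m⇒∣n (subst (b ∣_) (lemma A b (product bs) _) (m*n∣⇒m∣ b _ ∣w)) (m∣m*n _)
∣*weightedNumerator⇒≡0 {b ∷ bs} {ys = suc (suc _) ∷ _} (s≤s () ∷ _) _ _ _ _

∣*weightedNumerator+1⇒≡reciprocalNumerator : ∀ {A ys} → Pointwise _≤_ ys (ones bs) →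
  All (2 ≤_) bs → product bs ∣ A * weightedNumerator ys bs + 1 →
  weightedNumerator ys bs ≡ reciprocalNumerator bs
∣*weightedNumerator+1⇒≡reciprocalNumerator [] [] _ = refl
∣*weightedNumerator+1⇒≡reciprocalNumerator {b ∷ bs} {A} {0 ∷ ys} _ (b≥2 ∷ _) ∣w+1 =
  ⊥-elim (≥2⇒≢1 b≥2 (∣1⇒≡1 (∣m+n∣m⇒∣n b∣bAw+1 (n∣m*n (A * weightedNumerator ys bs)))))
  where
  lemma : ∀ A b P w → A * (0 * P + b * w) + 1 ≡ A * w * b + 1
  lemma = solve-∀
  b∣bAw+1 : b ∣ A * weightedNumerator ys bs * b + 1
  b∣bAw+1 = subst (b ∣_) (lemma A b (product bs) _) (m*n∣⇒m∣ b _ ∣w+1)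
∣*weightedNumerator+1⇒≡reciprocalNumerator {b ∷ bs} {A} {1 ∷ ys} (_ ∷ ys≤1) (_ ∷ bs≥2) ∣w+1 =
  cong (λ w → 1 * product bs + b * w)
       (∣*weightedNumerator+1⇒≡reciprocalNumerator {A = A * b} ys≤1 bs≥2
          (∣m+n∣m⇒∣n (subst (product bs ∣_) (lemma A b (product bs) _) (m*n∣⇒n∣ b _ ∣w+1))
                     (n∣m*n A)))
  where
  lemma : ∀ A b P w → A * (1 * P + b * w) + 1 ≡ A * P + (A * b * w + 1)
  lemma = solve-∀
∣*weightedNumerator+1⇒≡reciprocalNumerator {b ∷ bs} {ys = suc (suc _) ∷ _} (s≤s () ∷ _) _ _

record CoprimeDenominators (K : ℕ) (bs : List ℕ) : Set where
  field
    pairwiseCoprime : AllPairs Coprime bs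
    all≥2           : All (2 ≤_) bs
    coprimeTo       : All (λ b → Coprime b K) bs

product-nonZero : All (2 ≤_) bs → NonZero (product bs)
product-nonZero = product≢0 ∘ All.map ≥2⇒nonZero

coprimeDenominators-++ : ∀ {cs} → CoprimeDenominators (K * product bs) cs →
  CoprimeDenominators K bs → CoprimeDenominators K (cs ++ bs)
coprimeDenominators-++ {K} {bs} cs-ok bs-ok = record
  { pairwiseCoprime = AllPairsP.++⁺ (pairwiseCoprime cs-ok) (pairwiseCoprime bs-ok)
                        (All.map coprime-bs (coprimeTo cs-ok))
  ; all≥2           = AllP.++⁺ (all≥2 cs-ok) (all≥2 bs-ok)
  ; coprimeTo       = AllP.++⁺ (All.map (coprime-∣ʳ (m∣m*n _)) (coprimeTo cs-ok)) (coprimeTo bs-ok)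
  }
  where
  open CoprimeDenominators
  coprime-bs : ∀ {c} → Coprime c (K * product bs) → All (Coprime c) bs
  coprime-bs c⊥ = All.tabulate (λ b∈bs → coprime-∣ʳ (∣n⇒∣m*n K (∈⇒∣product b∈bs)) c⊥)

coprimeDenominators-tail : ∀ {b} → CoprimeDenominators K (b ∷ bs) → CoprimeDenominators K bs
coprimeDenominators-tail b∷bs-ok = record
  { pairwiseCoprime = AllPairs.tail pairwiseCoprime
  ; all≥2           = All.tail all≥2
  ; coprimeTo       = All.tail coprimeTo
  }
  where open CoprimeDenominators b∷bs-ok

coprimeDenominators-∣ : d ∣ K → CoprimeDenominators K bs → CoprimeDenominators d bs
coprimeDenominators-∣ d∣K bs-ok = record
  { pairwiseCoprime = pairwiseCoprime
  ; all≥2           = all≥2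
  ; coprimeTo       = All.map (coprime-∣ʳ d∣K) coprimeTo
  }
  where open CoprimeDenominators bs-ok

remainder-coprime : ∀ {M} → Coprime m n → CoprimeDenominators n bs →
  m * product bs ≡ n * reciprocalNumerator bs + M → Coprime M (n * product bs)
remainder-coprime {m} {n} {bs} {M} m⊥n bs-ok mB≡ = coprime-*ʳ M⊥n M⊥B
  where
  open CoprimeDenominators bs-ok
  B = product bs
  R = reciprocalNumerator bs
  n⊥B : Coprime n B
  n⊥B = coprime-productʳ (All.map coprime-sym coprimeTo)
  d∣mB : ∀ {d} → d ∣ M → d ∣ n * R → d ∣ m * B
  d∣mB {d} d∣M d∣nR = subst (d ∣_) (sym mB≡) (∣m∣n⇒∣m+n d∣nR d∣M)
  M⊥n : Coprime M n
  M⊥n (d∣M , d∣n) = coprime-*ʳ (coprime-sym m⊥n) n⊥B (d∣n , d∣mB d∣M (∣m⇒∣m*n R d∣n))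
  M⊥B : Coprime M B
  M⊥B {d} (d∣M , d∣B) =
    coprime-*ʳ (coprime-sym n⊥B) (coprime-sym (reciprocalNumerator-coprime pairwiseCoprime))
      (d∣B , ∣m+n∣m⇒∣n (subst (d ∣_) (trans mB≡ (+-comm _ M)) (∣n⇒∣m*n m d∣B)) d∣M)

-- Counting

∑ : List ℕ → (ℕ → ℕ) → ℕ
∑ xs f = sum (map f xs)

∑-+ : ∀ xs (f g : ℕ → ℕ) → ∑ xs (λ x → f x + g x) ≡ ∑ xs f + ∑ xs g
∑-+ []       f g = refl
∑-+ (x ∷ xs) f g = trans (cong (f x + g x +_) (∑-+ xs f g)) (interchange (f x) (g x) _ _)

∑-mono-≤ : ∀ xs {f g : ℕ → ℕ} → (∀ {x} → x ∈ xs → f x ≤ g x) → ∑ xs f ≤ ∑ xs g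
∑-mono-≤ []       f≤g = z≤n
∑-mono-≤ (x ∷ xs) f≤g = +-mono-≤ (f≤g (here refl)) (∑-mono-≤ xs (f≤g ∘ there))

∑-const : ∀ xs k → ∑ xs (λ _ → k) ≡ length xs * k
∑-const []       k = refl
∑-const (x ∷ xs) k = cong (k +_) (∑-const xs k)

length≤∑ : ∀ xs {f : ℕ → ℕ} → (∀ {x} → x ∈ xs → 1 ≤ f x) → length xs ≤ ∑ xs f
length≤∑ []       1≤f = z≤n
length≤∑ (x ∷ xs) 1≤f = +-mono-≤ (1≤f (here refl)) (length≤∑ xs (1≤f ∘ there))

∑-comm : ∀ (f : ℕ → ℕ → ℕ) xs ys →
  ∑ xs (λ x → ∑ ys (f x)) ≡ ∑ ys (λ y → ∑ xs (λ x → f x y))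
∑-comm f []       ys = sym (trans (∑-const ys 0) (*-zeroʳ (length ys)))
∑-comm f (x ∷ xs) ys =
  trans (cong (∑ ys (f x) +_) (∑-comm f xs ys))
        (sym (∑-+ ys (f x) (λ y → ∑ xs (λ x′ → f x′ y))))

∈⇒≤sum-map : ∀ {A : Set} {x : A} {xs} (f : A → ℕ) → x ∈ xs → f x ≤ sum (map f xs)
∈⇒≤sum-map f (here refl)            = m≤m+n _ _
∈⇒≤sum-map {xs = y ∷ _} f (there x∈) = ≤-trans (∈⇒≤sum-map f x∈) (m≤n+m _ (f y))

𝟙 : {P : Set} → Dec P → ℕ
𝟙 (yes _) = 1
𝟙 (no _)  = 0

𝟙-yes : {P : Set} (P? : Dec P) → P → 1 ≤ 𝟙 P?
𝟙-yes (yes _) _  = ≤-refl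
𝟙-yes (no ¬p) p = ⊥-elim (¬p p)

∑𝟙≡-∉ : ∀ {v} xs → All (_≢ v) xs → ∑ xs (λ x → 𝟙 (x ≟ v)) ≡ 0
∑𝟙≡-∉ []       []             = refl
∑𝟙≡-∉ {v} (x ∷ xs) (x≢v ∷ xs≢v) with x ≟ v
... | yes x≡v = ⊥-elim (x≢v x≡v)
... | no _    = ∑𝟙≡-∉ xs xs≢v

∑𝟙≡≤1 : ∀ {v xs} → AllPairs _≢_ xs → ∑ xs (λ x → 𝟙 (x ≟ v)) ≤ 1
∑𝟙≡≤1 {v} {[]}     []             = z≤n
∑𝟙≡≤1 {v} {x ∷ xs} (x≢xs ∷ xs≢) with x ≟ v
... | yes refl = ≤-reflexive (cong suc (∑𝟙≡-∉ xs (All.map (_∘ sym) x≢xs)))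
... | no _     = ∑𝟙≡≤1 xs≢

-- range N = [N, N - 1, …, 1]
range : ℕ → List ℕ
range = applyDownFrom suc

∈-range⁺ : 1 ≤ n → n ≤ k → n ∈ range k
∈-range⁺ {suc n} _ n≤k = ∈-applyDownFrom⁺ suc n≤k

∈-range⁻ : n ∈ range k → 1 ≤ n × n ≤ k
∈-range⁻ n∈ with ∈-applyDownFrom⁻ suc n∈
... | i , i<k , refl = s≤s z≤n , i<k

range-distinct : ∀ k → AllPairs (λ x y → y < x) (range k)
range-distinct k = AllPairsP.applyDownFrom⁺₁ suc k (λ j<i _ → s≤s j<i)

length-range : ∀ N → length (range N) ≡ N
length-range = length-applyDownFrom suc

multiples : ℕ → ℕ → ℕ
multiples p N = ∑ (range N) (λ n → 𝟙 (p ∣? n))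

multiples-divMod : ∀ p N → .{{NonZero p}} → ∃ λ r → r < p × N ≡ p * multiples p N + r
multiples-divMod p zero = 0 , >-nonZero⁻¹ p , sym (trans (+-identityʳ (p * 0)) (*-zeroʳ p))
multiples-divMod p (suc N) with multiples-divMod p N | p ∣? suc N
... | r , r<p , N≡ | yes p∣N+1 = 0 , >-nonZero⁻¹ p , (begin
    suc N                    ≡⟨ N+1≡ ⟩
    p * count + suc r        ≡⟨ cong (p * count +_) r+1≡p ⟩
    p * count + p            ≡⟨ lemma p count ⟩
    p * (1 + count) + 0      ∎)
  where
  open ≡-Reasoning
  count = multiples p N
  N+1≡ : suc N ≡ p * count + suc r
  N+1≡ = trans (cong suc N≡) (sym (+-suc (p * count) r))
  r+1≡p : suc r ≡ p
  r+1≡p = ≤-antisym r<p (∣⇒≤ (∣m+n∣m⇒∣n (subst (p ∣_) N+1≡ p∣N+1) (m∣m*n count)))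
  lemma : ∀ p c → p * c + p ≡ p * (1 + c) + 0
  lemma = solve-∀
... | r , r<p , N≡ | no p∤N+1 = suc r , ≤∧≢⇒< r<p r+1≢p , trans (cong suc N≡) (sym (+-suc _ r))
  where
  lemma : ∀ p c → p * c + p ≡ (1 + c) * p
  lemma = solve-∀
  r+1≢p : suc r ≢ p
  r+1≢p refl = p∤N+1 (divides (1 + multiples p N)
    (trans (cong suc N≡) (trans (sym (+-suc _ r)) (lemma p (multiples p N)))))

*-multiples≤ : ∀ p N → .{{NonZero p}} → p * multiples p N ≤ N
*-multiples≤ p N with r , _ , N≡ ← multiples-divMod p N =
  subst (p * multiples p N ≤_) (sym N≡) (m≤m+n _ r)

∑-representations≤ : ∀ {ns} (g : ℕ → ℕ → ℕ) xs ys → AllPairs _≢_ ns →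
  ∑ ns (λ n → ∑ xs (λ x → ∑ ys (λ y → 𝟙 (n ≟ g x y)))) ≤ length xs * length ys
∑-representations≤ {ns} g xs ys ns-distinct = begin
  ∑ ns (λ n → ∑ xs (λ x → ∑ ys (λ y → 𝟙 (n ≟ g x y))))
    ≡⟨ ∑-comm _ ns xs ⟩
  ∑ xs (λ x → ∑ ns (λ n → ∑ ys (λ y → 𝟙 (n ≟ g x y))))
    ≡⟨ cong sum (map-cong (λ x → ∑-comm (λ n y → 𝟙 (n ≟ g x y)) ns ys) xs) ⟩
  ∑ xs (λ x → ∑ ys (λ y → ∑ ns (λ n → 𝟙 (n ≟ g x y))))
    ≤⟨ ∑-mono-≤ xs (λ _ → ∑-mono-≤ ys (λ _ → ∑𝟙≡≤1 ns-distinct)) ⟩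
  ∑ xs (λ x → ∑ ys (λ y → 1))
    ≡⟨ ∑-const xs _ ⟩
  length xs * ∑ ys (λ y → 1)
    ≡⟨ cong (length xs *_) (trans (∑-const ys 1) (*-identityʳ _)) ⟩
  length xs * length ys ∎
  where open ≤-Reasoning

product*∑≤*reciprocalNumerator : ∀ N (f : ℕ → ℕ) ps → All (λ p → p * f p ≤ N) ps →
  product ps * ∑ ps f ≤ N * reciprocalNumerator ps
product*∑≤*reciprocalNumerator N f []       []             = z≤n
product*∑≤*reciprocalNumerator N f (p ∷ ps) (pf≤N ∷ ps≤N) = begin
  p * P * (f p + ∑ ps f)              ≡⟨ lemma₁ p P (f p) (∑ ps f) ⟩
  p * f p * P + p * (P * ∑ ps f)      ≤⟨ +-mono-≤ (*-monoˡ-≤ P pf≤N) (*-monoʳ-≤ p IH) ⟩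
  N * P + p * (N * R)                 ≡⟨ lemma₂ N p P R ⟩
  N * (1 * P + p * R)                 ∎
  where
  open ≤-Reasoning
  P = product ps
  R = reciprocalNumerator ps
  IH : P * ∑ ps f ≤ N * R
  IH = product*∑≤*reciprocalNumerator N f ps ps≤N
  lemma₁ : ∀ p P x s → p * P * (x + s) ≡ p * x * P + p * (P * s)
  lemma₁ = solve-∀
  lemma₂ : ∀ N p P R → N * P + p * (N * R) ≡ N * (1 * P + p * R)
  lemma₂ = solve-∀

≤square⇒≤ : ∀ {r R} → r * r ≤ R * R → r ≤ R
≤square⇒≤ {r} {R} r²≤R² with r ≤? R
... | yes r≤R = r≤R
... | no r≰R  = ⊥-elim (<⇒≱ (*-mono-< (≰⇒> r≰R) (≰⇒> r≰R)) r²≤R²)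

-- Primes avoiding K

product≡divisor*square : ∀ ps → All Prime ps → All (_∣ K) ps →
  ∃₂ λ s r → product ps ≡ s * (r * r) × s ∣ K
product≡divisor*square {K} [] [] [] = 1 , 1 , refl , 1∣ K
product≡divisor*square (p ∷ ps) (p-prime ∷ ps-prime) (p∣K ∷ ps∣K)
  with product≡divisor*square ps ps-prime ps∣K
... | s , r , ps≡ , s∣K with p ∣? s
...   | yes (divides s′ refl) =
        s′ , p * r , trans (cong (p *_) ps≡) (lemma p s′ r) , ∣-trans (m∣m*n p) s∣K
  where
  lemma : ∀ p s r → p * (s * p * (r * r)) ≡ s * (p * r * (p * r))
  lemma = solve-∀
...   | no p∤s =
        p * s , r , trans (cong (p *_) ps≡) (sym (*-assoc p s _)) ,
        coprime-∣⇒*∣ (prime-∤⇒coprime p-prime p∤s) p∣K s∣K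

divisor*square : ∀ n → .{{NonZero n}} → (∀ {p} → Prime p → p ∣ n → p ∣ K) →
  ∃₂ λ s r → n ≡ s * (r * r) × s ∣ K
divisor*square {K} n prime∣K =
  let s , r , ps≡ , s∣K = product≡divisor*square ps factorsPrime (All.tabulate ∣K)
  in  s , r , trans isFactorisation ps≡ , s∣K
  where
  open PrimeFactorisation (factorise n) renaming (factors to ps)
  ∣K : ∀ {p} → p ∈ ps → p ∣ K
  ∣K {p} p∈ps = prime∣K (All.lookup factorsPrime p∈ps)
                        (subst (p ∣_) (sym isFactorisation) (∈⇒∣product p∈ps))

primesAvoiding : ℕ → ℕ → List ℕ
primesAvoiding K N = filter (λ p → prime? p ×-dec ¬? (p ∣? K)) (range N)

∈-primesAvoiding⁺ : ∀ {p N} → Prime p → ¬ p ∣ K → p ≤ N → p ∈ primesAvoiding K N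
∈-primesAvoiding⁺ p-prime p∤K p≤N =
  ∈-filter⁺ _ (∈-range⁺ (>-nonZero⁻¹ _ {{prime⇒nonZero p-prime}}) p≤N) (p-prime , p∤K)

primesAvoiding-prime : ∀ K N → All (λ p → Prime p × ¬ p ∣ K) (primesAvoiding K N)
primesAvoiding-prime K N = all-filter _ (range N)

decreasingPrimes⇒pairwiseCoprime : ∀ {ps} → All Prime ps → AllPairs (λ p q → q < p) ps →
  AllPairs Coprime ps
decreasingPrimes⇒pairwiseCoprime []                     []            = []
decreasingPrimes⇒pairwiseCoprime {p ∷ _} (p-prime ∷ ps-prime) (p>ps ∷ ps>) =
  All.zipWith coprime-smallerPrime (ps-prime , p>ps) ∷ decreasingPrimes⇒pairwiseCoprime ps-prime ps>
  where
  coprime-smallerPrime : ∀ {q} → Prime q × q < p → Coprime p q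
  coprime-smallerPrime (q-prime , q<p) = prime⇒coprime p-prime {{prime⇒nonZero q-prime}} q<p

primesAvoiding-coprimeDenominators : ∀ K N → CoprimeDenominators K (primesAvoiding K N)
primesAvoiding-coprimeDenominators K N = record
  { pairwiseCoprime = decreasingPrimes⇒pairwiseCoprime (All.map proj₁ primality)
                        (AllPairsP.filter⁺ _ (range-distinct N))
  ; all≥2           = All.map (λ (p-prime , _) → nonTrivial⇒n>1 _ {{prime⇒nonTrivial p-prime}}) primality
  ; coprimeTo       = All.map (λ (p-prime , p∤K) {d} → prime-∤⇒coprime p-prime p∤K {d}) primality
  }
  where
  primality : All (λ p → Prime p × ¬ p ∣ K) (primesAvoiding K N)
  primality = primesAvoiding-prime K N

avoidingPrimeFactor⊎divisor*square : ∀ K N n → .{{NonZero n}} → n ≤ N →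
  (∃ λ p → p ∈ primesAvoiding K N × p ∣ n) ⊎ (∃₂ λ s r → n ≡ s * (r * r) × s ∣ K)
avoidingPrimeFactor⊎divisor*square K N n n≤N with any? (_∣? n) (primesAvoiding K N)
... | yes ∃p = inj₁ (find ∃p)
... | no ∄p  = inj₂ (divisor*square n prime∣K)
  where
  prime∣K : ∀ {p} → Prime p → p ∣ n → p ∣ K
  prime∣K {p} p-prime p∣n with p ∣? K
  ... | yes p∣K = p∣K
  ... | no p∤K  =
    ⊥-elim (∄p (lose (∈-primesAvoiding⁺ p-prime p∤K (≤-trans (∣⇒≤ p∣n) n≤N)) p∣n))

-- The two sums count the prime divisors of n in the list and the representations n = s r².
avoidingPrimeFactor+representations≥1 : ∀ K R {n} → .{{NonZero K}} → n ∈ range (R * R) →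
  1 ≤ ∑ (primesAvoiding K (R * R)) (λ p → 𝟙 (p ∣? n))
    + ∑ (range K) (λ s → ∑ (range R) (λ r → 𝟙 (n ≟ s * (r * r))))
avoidingPrimeFactor+representations≥1 K R {n} n∈ with 1≤n , n≤R² ← ∈-range⁻ n∈
  with avoidingPrimeFactor⊎divisor*square K (R * R) n {{>-nonZero 1≤n}} n≤R²
... | inj₁ (p , p∈ps , p∣n) =
  ≤-trans (≤-trans (𝟙-yes (p ∣? n) p∣n) (∈⇒≤sum-map _ p∈ps)) (m≤m+n _ _)
... | inj₂ (s , r , refl , s∣K) = begin
  1                                                    ≤⟨ 𝟙-yes (n ≟ s * (r * r)) refl ⟩
  𝟙 (n ≟ s * (r * r))                                  ≤⟨ ∈⇒≤sum-map _ (∈-range⁺ 1≤r r≤R) ⟩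
  ∑ (range R) (λ r′ → 𝟙 (n ≟ s * (r′ * r′)))           ≤⟨ ∈⇒≤sum-map _ (∈-range⁺ 1≤s (∣⇒≤ s∣K)) ⟩
  ∑ (range K) (λ s′ → ∑ (range R) (λ r′ → 𝟙 (n ≟ s′ * (r′ * r′))))
                                                       ≤⟨ m≤n+m _ _ ⟩
  _                                                    ∎
  where
  open ≤-Reasoning
  instance
    _ : NonZero (s * (r * r))
    _ = >-nonZero 1≤n
  1≤s : 1 ≤ s
  1≤s = >-nonZero⁻¹ s {{m*n≢0⇒m≢0 s}}
  1≤r : 1 ≤ r
  1≤r = >-nonZero⁻¹ r {{m*n≢0⇒m≢0 r {{m*n≢0⇒n≢0 s}}}}
  r≤R : r ≤ R
  r≤R = ≤square⇒≤ (≤-trans (m≤n*m (r * r) s {{>-nonZero 1≤s}}) n≤R²)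

-- Summed over n ≤ (2K)², the representations s r² number at most 2K², so the
-- multiples of the primes in ps number at least half of (2K)².
primesAvoiding-reciprocalSum : ∀ K → .{{NonZero K}} →
  ∃ λ ps → CoprimeDenominators K ps × product ps ≤ 2 * reciprocalNumerator ps
primesAvoiding-reciprocalSum K = ps , primesAvoiding-coprimeDenominators K N ,
  *-cancelˡ-≤ (K * R) {{m*n≢0 K R {{it}} {{m*n≢0 2 K}}}} (begin
    K * R * product ps                 ≡⟨ *-comm (K * R) _ ⟩
    product ps * (K * R)               ≤⟨ *-monoʳ-≤ (product ps) KR≤∑multiples ⟩
    product ps * ∑ ps (λ p → multiples p N)
                                       ≤⟨ product*∑≤*reciprocalNumerator N _ ps p*multiples≤N ⟩
    N * reciprocalNumerator ps         ≡⟨ lemma₁ K (reciprocalNumerator ps) ⟩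
    K * R * (2 * reciprocalNumerator ps) ∎)
  where
  open ≤-Reasoning
  R = 2 * K
  N = R * R
  ps = primesAvoiding K N
  lemma₁ : ∀ K r → 2 * K * (2 * K) * r ≡ K * (2 * K) * (2 * r)
  lemma₁ = solve-∀
  lemma₂ : ∀ K → K * (2 * K) + K * (2 * K) ≡ 2 * K * (2 * K)
  lemma₂ = solve-∀
  p*multiples≤N : All (λ p → p * multiples p N ≤ N) ps
  p*multiples≤N = All.map (λ (p-prime , _) → *-multiples≤ _ N {{prime⇒nonZero p-prime}})
                          (primesAvoiding-prime K N)
  A S : ℕ → ℕ
  A n = ∑ ps (λ p → 𝟙 (p ∣? n))
  S n = ∑ (range K) (λ s → ∑ (range R) (λ r → 𝟙 (n ≟ s * (r * r))))
  ∑S≤KR : ∑ (range N) S ≤ K * R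
  ∑S≤KR = subst₂ (λ x y → ∑ (range N) S ≤ x * y) (length-range K) (length-range R)
            (∑-representations≤ (λ s r → s * (r * r)) (range K) (range R)
               (AllPairs.map (λ y<x → ≢-sym (<⇒≢ y<x)) (range-distinct N)))
  KR≤∑multiples : K * R ≤ ∑ ps (λ p → multiples p N)
  KR≤∑multiples = +-cancelʳ-≤ (K * R) (K * R) _ (begin
    K * R + K * R                      ≡⟨ lemma₂ K ⟩
    N                                  ≡⟨ length-range N ⟨
    length (range N)                   ≤⟨ length≤∑ (range N) (avoidingPrimeFactor+representations≥1 K R) ⟩
    ∑ (range N) (λ n → A n + S n)      ≡⟨ ∑-+ (range N) A S ⟩
    ∑ (range N) A + ∑ (range N) S      ≡⟨ cong (_+ ∑ (range N) S) (∑-comm (λ n p → 𝟙 (p ∣? n)) (range N) ps) ⟩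
    ∑ ps (λ p → multiples p N) + ∑ (range N) S
                                       ≤⟨ +-monoʳ-≤ _ ∑S≤KR ⟩
    ∑ ps (λ p → multiples p N) + K * R ∎)

reciprocalSum-++ : ∀ j bs cs → product cs ≤ 2 * reciprocalNumerator cs →
  j * product bs ≤ 2 * reciprocalNumerator bs → suc j * product (cs ++ bs) ≤ 2 * reciprocalNumerator (cs ++ bs)
reciprocalSum-++ j bs cs cs-sum bs-sum = begin
  suc j * product (cs ++ bs)           ≡⟨ cong (suc j *_) (product-++ cs bs) ⟩
  suc j * (C * B)                      ≡⟨ lemma₁ j C B ⟩
  C * B + C * (j * B)                  ≤⟨ +-mono-≤ (*-monoˡ-≤ B cs-sum) (*-monoʳ-≤ C bs-sum) ⟩
  2 * Rc * B + C * (2 * Rb)            ≡⟨ lemma₂ Rc B C Rb ⟩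
  2 * (Rc * B + C * Rb)                ≡⟨ cong (2 *_) (reciprocalNumerator-++ cs bs) ⟨
  2 * reciprocalNumerator (cs ++ bs)   ∎
  where
  open ≤-Reasoning
  B = product bs
  C = product cs
  Rb = reciprocalNumerator bs
  Rc = reciprocalNumerator cs
  lemma₁ : ∀ j C B → suc j * (C * B) ≡ C * B + C * (j * B)
  lemma₁ = solve-∀
  lemma₂ : ∀ r B C s → 2 * r * B + C * (2 * s) ≡ 2 * (r * B + C * s)
  lemma₂ = solve-∀

-- Concatenate j blocks of primes, each avoiding K and all earlier blocks.
coprimeDenominators-reciprocalSum : ∀ j K → .{{NonZero K}} →
  ∃ λ bs → CoprimeDenominators K bs × j * product bs ≤ 2 * reciprocalNumerator bs
coprimeDenominators-reciprocalSum zero    K =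
  [] , record { pairwiseCoprime = [] ; all≥2 = [] ; coprimeTo = [] } , z≤n
coprimeDenominators-reciprocalSum (suc j) K =
  let bs , bs-ok , bs-sum = coprimeDenominators-reciprocalSum j K
      cs , cs-ok , cs-sum = primesAvoiding-reciprocalSum (K * product bs)
                              {{m*n≢0 K _ {{it}} {{product-nonZero (CoprimeDenominators.all≥2 bs-ok)}}}}
  in  cs ++ bs , coprimeDenominators-++ cs-ok bs-ok , reciprocalSum-++ j bs cs cs-sum bs-sum

reciprocalSum-exceeding : ∀ m n K → .{{NonZero n}} → .{{NonZero K}} →
  ∃ λ bs → CoprimeDenominators K bs × m * product bs ≤ n * reciprocalNumerator bs
reciprocalSum-exceeding m n K with bs , bs-ok , 2mB≤2R ← coprimeDenominators-reciprocalSum (2 * m) K =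
  bs , bs-ok ,
  ≤-trans (*-cancelˡ-≤ 2 (subst (_≤ 2 * reciprocalNumerator bs) (*-assoc 2 m _) 2mB≤2R)) (m≤n*m _ n)

-- Dropping denominators from the front until the sum first falls below m/n leaves
-- a tail whose sum is below m/n by less than 1/b ≤ 1/2.
straddlingTail : ∀ m n K bs → 1 ≤ m → CoprimeDenominators K bs →
  m * product bs ≤ n * reciprocalNumerator bs →
  ∃ λ ds → CoprimeDenominators K ds ×
    ∃ λ M → m * product ds ≡ n * reciprocalNumerator ds + M × 1 ≤ M × M < n * product ds
straddlingTail (suc m) n K [] _ _ m≤0 =
  ⊥-elim (<⇒≱ (s≤s z≤n) (≤-trans m≤0 (≤-reflexive (*-zeroʳ n))))
straddlingTail m n K (b ∷ bs) 1≤m b∷bs-ok sum≥ with m * product bs ≤? n * reciprocalNumerator bs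
... | yes sum′≥ = straddlingTail m n K bs 1≤m (coprimeDenominators-tail b∷bs-ok) sum′≥
... | no sum′≱  = bs , coprimeDenominators-tail b∷bs-ok , M , mB≡ , 1≤M , <-≤-trans M<bM bM≤nB
  where
  B = product bs
  R = reciprocalNumerator bs
  nR<mB : n * R < m * B
  nR<mB = ≰⇒> sum′≱
  M = m * B ∸ n * R
  mB≡ : m * B ≡ n * R + M
  mB≡ = sym (m+[n∸m]≡n (<⇒≤ nR<mB))
  1≤M : 1 ≤ M
  1≤M = m<n⇒0<n∸m nR<mB
  M<bM : M < b * M
  M<bM = subst (M <_) (*-comm M b)
                (m<m*n M b {{>-nonZero 1≤M}} (All.head (CoprimeDenominators.all≥2 b∷bs-ok)))
  lemma₁ : ∀ b m B → b * (m * B) ≡ m * (b * B)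
  lemma₁ = solve-∀
  lemma₂ : ∀ n B b R → n * (1 * B + b * R) ≡ b * (n * R) + n * B
  lemma₂ = solve-∀
  bM≤nB : b * M ≤ n * B
  bM≤nB = +-cancelˡ-≤ (b * (n * R)) _ _ (begin
    b * (n * R) + b * M          ≡⟨ *-distribˡ-+ b (n * R) M ⟨
    b * (n * R + M)              ≡⟨ cong (b *_) mB≡ ⟨
    b * (m * B)                  ≡⟨ lemma₁ b m B ⟩
    m * (b * B)                  ≤⟨ sum≥ ⟩
    n * (1 * B + b * R)          ≡⟨ lemma₂ n B b R ⟩
    b * (n * R) + n * B          ∎)
    where open ≤-Reasoning

-- Fractions

frac-≡ : ∀ {a a′ d d′} → .{{NonZero d}} → .{{NonZero d′}} →
  a * d′ ≡ a′ * d → frac (ℤ.+ a) d ≡ frac (ℤ.+ a′) d′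
frac-≡ {a} {a′} {suc d} {suc d′} eq =
  fromℚᵘ-cong {mkℚᵘ (ℤ.+ a) d} {mkℚᵘ (ℤ.+ a′) d′} (*≡* (begin
  ℤ.+ a ℤ.* ℤ.+ suc d′    ≡⟨ ℤ.pos-* a (suc d′) ⟨
  ℤ.+ (a * suc d′)        ≡⟨ cong ℤ.+_ eq ⟩
  ℤ.+ (a′ * suc d)        ≡⟨ ℤ.pos-* a′ (suc d) ⟩
  ℤ.+ a′ ℤ.* ℤ.+ suc d    ∎))
  where open ≡-Reasoning

frac≡frac⇒∣ : ∀ {a z d n} → .{{NonZero d}} → .{{NonZero n}} →
  frac (ℤ.+ a) d ≡ frac z n → d ∣ a * n
frac≡frac⇒∣ {a} {z} {suc d} {suc n} eq = nonNegative z cross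
  where
  cross : ℤ.+ a ℤ.* ℤ.+ suc n ≡ z ℤ.* ℤ.+ suc d
  cross with *≡* e ← /-injective-≃ (mkℚᵘ (ℤ.+ a) d) (mkℚᵘ z n) eq = e
  nonNegative : ∀ z → ℤ.+ a ℤ.* ℤ.+ suc n ≡ z ℤ.* ℤ.+ suc d → suc d ∣ a * suc n
  nonNegative (ℤ.+ k) e =
    divides k (ℤ.+-injective (trans (ℤ.pos-* a (suc n)) (trans e (sym (ℤ.pos-* k (suc d))))))
  nonNegative ℤ.-[1+ k ] e with () ← trans (ℤ.pos-* a (suc n)) e

frac-+ : ∀ a a′ d d′ → .{{NonZero d}} → .{{NonZero d′}} →
  frac (ℤ.+ a) d ℚ.+ frac (ℤ.+ a′) d′ ≡ frac (ℤ.+ (a * d′ + a′ * d)) (d * d′)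
frac-+ a a′ (suc d) (suc d′) = begin
  u ℚ.+ v
    ≡⟨ fromℚᵘ-toℚᵘ (u ℚ.+ v) ⟨
  fromℚᵘ (ℚ.toℚᵘ (u ℚ.+ v))
    ≡⟨ fromℚᵘ-cong (ℚᵘ.≃-trans (toℚᵘ-homo-+ u v)
                               (ℚᵘ.+-cong (toℚᵘ-fromℚᵘ P) (toℚᵘ-fromℚᵘ Q))) ⟩
  fromℚᵘ (P ℚᵘ.+ Q)
    ≡⟨ cong (λ z → fromℚᵘ (mkℚᵘ z _)) numerator ⟩
  frac (ℤ.+ (a * suc d′ + a′ * suc d)) (suc d * suc d′) ∎
  where
  open ≡-Reasoning
  P = mkℚᵘ (ℤ.+ a) d
  Q = mkℚᵘ (ℤ.+ a′) d′
  u = fromℚᵘ P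
  v = fromℚᵘ Q
  numerator : ℤ.+ a ℤ.* ℤ.+ suc d′ ℤ.+ ℤ.+ a′ ℤ.* ℤ.+ suc d ≡
              ℤ.+ (a * suc d′ + a′ * suc d)
  numerator = sym (trans (ℤ.pos-+ (a * suc d′) (a′ * suc d))
                         (cong₂ ℤ._+_ (ℤ.pos-* a (suc d′)) (ℤ.pos-* a′ (suc d))))

frac-0 : ∀ d → .{{NonZero d}} → frac (ℤ.+ 0) d ≡ 0ℚ
frac-0 d = frac-≡ {0} {0} {d} {1} refl

Pointwise-++⁻ : ∀ {R : ℕ → ℕ → Set} {xs} as bs → Pointwise R xs (as ++ bs) →
  ∃₂ λ xs₁ xs₂ → xs ≡ xs₁ ++ xs₂ × Pointwise R xs₁ as × Pointwise R xs₂ bs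
Pointwise-++⁻ []       bs xs∼bs = [] , _ , refl , [] , xs∼bs
Pointwise-++⁻ (a ∷ as) bs (x∼a ∷ xs∼)
  with xs₁ , xs₂ , refl , xs₁∼ , xs₂∼ ← Pointwise-++⁻ as bs xs∼ =
  _ ∷ xs₁ , xs₂ , refl , x∼a ∷ xs₁∼ , xs₂∼

zip-++ : ∀ (xs : List ℕ) {ys} (as : List ℕ) {bs : List ℕ} → length xs ≡ length as →
  zip (xs ++ ys) (as ++ bs) ≡ zip xs as ++ zip ys bs
zip-++ []       []       _     = refl
zip-++ (x ∷ xs) (a ∷ as) |xs|≡ = cong ((x , a) ∷_) (zip-++ xs as (suc-injective |xs|≡))

termsSum-++ : ∀ ts us → termsSum (ts ++ us) ≡ termsSum ts ℚ.+ termsSum us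
termsSum-++ []             us = sym (ℚ.+-identityˡ _)
termsSum-++ ((a , b) ∷ ts) us =
  trans (cong (frac (ℤ.+ a) b ℚ.+_) (termsSum-++ ts us)) (sym (ℚ.+-assoc (frac (ℤ.+ a) b) _ _))

termsSum-zip : ∀ ys bs → length ys ≡ length bs → All NonZero bs →
  termsSum (zip ys bs) ≡ frac (ℤ.+ weightedNumerator ys bs) (product bs)
termsSum-zip []       []       _     []           = refl
termsSum-zip (y ∷ ys) (b ∷ bs) |ys|≡ (b≢0 ∷ bs≢0) = begin
  frac (ℤ.+ y) b ℚ.+ termsSum (zip ys bs)
    ≡⟨ cong (frac (ℤ.+ y) b ℚ.+_) (termsSum-zip ys bs (suc-injective |ys|≡) bs≢0) ⟩
  frac (ℤ.+ y) b ℚ.+ frac (ℤ.+ w) B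
    ≡⟨ frac-+ y w b B {{b≢0}} {{product≢0 bs≢0}} ⟩
  frac (ℤ.+ (y * B + w * b)) (b * B)
    ≡⟨ cong (λ z → frac (ℤ.+ (y * B + z)) (b * B)) (*-comm w b) ⟩
  frac (ℤ.+ (y * B + b * w)) (b * B) ∎
  where
  open ≡-Reasoning
  B = product bs
  w = weightedNumerator ys bs

-- The expansion and its faithfulness

-- Clearing denominators in  m/n = Σ_{b ∈ L} 1/b + x/c + 1/(n c ∏L).
record Expansion (m n : ℕ) (L : List ℕ) (x c : ℕ) : Set where
  field
    denominators : CoprimeDenominators (n * c) L
    c⊥nB         : Coprime c (n * product L)
    1≤x          : 1 ≤ x
    x<c          : x < c
    2≤nB         : 2 ≤ n * product L
    identity     : n * (reciprocalNumerator L * c + x * product L) + 1 ≡ m * (product L * c)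

-- With m/n − Σ_{b ∈ ds} 1/b = M/(n B), a solution of  M c = n B x + 1  gives
-- M/(n B) = x/c + 1/(n B c).
remainderExpansion : ∀ {ds M x} → CoprimeDenominators n ds →
  m * product ds ≡ n * reciprocalNumerator ds + M → 1 ≤ M → M < n * product ds →
  M * c ≡ n * product ds * x + 1 → 2 ≤ c → Expansion m n ds x c
remainderExpansion {n} {m} {c} {ds} {M} {x} ds-ok mB≡ 1≤M M<nB Mc≡ c≥2 = record
  { denominators = record { pairwiseCoprime = pairwiseCoprime ; all≥2 = all≥2
                          ; coprimeTo = All.zipWith b⊥nc (coprimeTo , All.tabulate ∈⇒∣product) }
  ; c⊥nB         = c⊥nB
  ; 1≤x          = positive x Mc≡
  ; x<c          = *-cancelˡ-< (n * B) x c (begin-strict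
                     n * B * x       <⟨ m<m+n _ z<s ⟩
                     n * B * x + 1   ≡⟨ Mc≡ ⟨
                     M * c           ≤⟨ *-monoˡ-≤ c (<⇒≤ M<nB) ⟩
                     n * B * c       ∎)
  ; 2≤nB         = ≤-<-trans 1≤M M<nB
  ; identity     = begin-equality
                     n * (R * c + x * B) + 1      ≡⟨ lemma n R c x B ⟩
                     n * R * c + (n * B * x + 1)  ≡⟨ cong (n * R * c +_) Mc≡ ⟨
                     n * R * c + M * c            ≡⟨ *-distribʳ-+ c (n * R) M ⟨
                     (n * R + M) * c              ≡⟨ cong (_* c) mB≡ ⟨
                     m * B * c                    ≡⟨ *-assoc m B c ⟩
                     m * (B * c)                  ∎
  }
  where
  open CoprimeDenominators ds-ok
  open ≤-Reasoning
  B = product ds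
  R = reciprocalNumerator ds
  lemma : ∀ n R c x B → n * (R * c + x * B) + 1 ≡ n * R * c + (n * B * x + 1)
  lemma = solve-∀
  c⊥nB : Coprime c (n * B)
  c⊥nB = *+1⇒coprime {M} Mc≡
  b⊥nc : ∀ {b} → Coprime b n × b ∣ B → Coprime b (n * c)
  b⊥nc (b⊥n , b∣B) = coprime-*ʳ b⊥n (coprime-sym (coprime-∣ʳ (∣n⇒∣m*n n b∣B) c⊥nB))
  positive : ∀ x → M * c ≡ n * B * x + 1 → 1 ≤ x
  positive (suc _) _   = s≤s z≤n
  positive zero    Mc≡ = ⊥-elim (<⇒≱ (≤-trans c≥2 (m≤n*m c M {{>-nonZero 1≤M}}))
                                     (≤-reflexive (trans Mc≡ (cong (_+ 1) (*-zeroʳ (n * B))))))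

-- Σᵢ yᵢ/bᵢ + y_c/c + y/(n c ∏L) = subsumNumerator n c L ys y_c y / (n c ∏L).
subsumNumerator : ℕ → ℕ → List ℕ → List ℕ → ℕ → ℕ → ℕ
subsumNumerator n c L ys yc y = n * (weightedNumerator ys L * c + yc * product L) + y

expansion-∣subsumNumerator : ∀ {L x ys yc y} → Expansion m n L x c →
  Pointwise _≤_ ys (ones L) → yc ≤ x → y ≤ 1 → product L * c ∣ subsumNumerator n c L ys yc y →
  subsumNumerator n c L ys yc y ≡ 0 ⊎ subsumNumerator n c L ys yc y ≡ m * (product L * c)
expansion-∣subsumNumerator {m} {n} {c} {L} {x} {ys} {yc} e ys≤1 yc≤x z≤n BC∣V = inj₁ (begin
  n * (w * c + yc * B) + 0      ≡⟨ cong₂ (λ u v → n * (u * c + v * B) + 0) w≡0 yc≡0 ⟩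
  n * (0 * c + 0 * B) + 0       ≡⟨ cong (_+ 0) (*-zeroʳ n) ⟩
  0                             ∎)
  where
  open ≡-Reasoning
  open Expansion e
  open CoprimeDenominators denominators
  B = product L
  w = weightedNumerator ys L
  lemma₁ : ∀ n w c yc B → n * (w * c + yc * B) + 0 ≡ c * (n * w) + n * B * yc
  lemma₁ = solve-∀
  lemma₂ : ∀ n w c B → n * (w * c + 0 * B) + 0 ≡ n * c * w
  lemma₂ = solve-∀
  c∣nByc : c ∣ n * B * yc
  c∣nByc = ∣m+n∣m⇒∣n (subst (c ∣_) (lemma₁ n w c yc B) (m*n∣⇒n∣ B c BC∣V)) (m∣m*n (n * w))
  yc≡0 : yc ≡ 0
  yc≡0 = ∣<⇒≡0 (coprime-divisor c⊥nB c∣nByc) (≤-<-trans yc≤x x<c)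
  w≡0 : w ≡ 0
  w≡0 = ∣*weightedNumerator⇒≡0 ys≤1 all≥2 pairwiseCoprime coprimeTo
          (subst (B ∣_) (lemma₂ n w c B)
                 (subst (λ z → B ∣ n * (w * c + z * B) + 0) yc≡0 (m*n∣⇒m∣ B c BC∣V)))
expansion-∣subsumNumerator {m} {n} {c} {L} {x} {ys} {yc} e ys≤1 yc≤x (s≤s z≤n) BC∣V = inj₂ (begin
  n * (w * c + yc * B) + 1      ≡⟨ cong₂ (λ u v → n * (u * c + v * B) + 1) w≡R yc≡x ⟩
  n * (R * c + x * B) + 1       ≡⟨ identity ⟩
  m * (B * c)                   ∎)
  where
  open ≡-Reasoning
  open Expansion e
  open CoprimeDenominators denominators
  B = product L
  R = reciprocalNumerator L
  w = weightedNumerator ys L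
  lemma₁ : ∀ n w c yc B → n * (w * c + yc * B) + 1 ≡ B * (n * yc) + (n * c * w + 1)
  lemma₁ = solve-∀
  lemma₂ : ∀ n w c yc B → n * (w * c + yc * B) + 1 ≡ c * (n * w) + (n * B * yc + 1)
  lemma₂ = solve-∀
  w≡R : w ≡ R
  w≡R = ∣*weightedNumerator+1⇒≡reciprocalNumerator {A = n * c} ys≤1 all≥2
          (∣m+n∣m⇒∣n (subst (B ∣_) (lemma₁ n w c yc B) (m*n∣⇒m∣ B c BC∣V)) (m∣m*n (n * yc)))
  c∣nByc+1 : c ∣ n * B * yc + 1
  c∣nByc+1 = ∣m+n∣m⇒∣n (subst (c ∣_) (lemma₂ n w c yc B) (m*n∣⇒n∣ B c BC∣V)) (m∣m*n (n * w))
  c∣nBx+1 : c ∣ n * B * x + 1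
  c∣nBx+1 = ∣m+n∣m⇒∣n (subst (c ∣_) (trans (sym identity) (lemma₂ n R c x B))
                                     (∣n⇒∣m*n m (n∣m*n B)))
                      (m∣m*n (n * R))
  yc≡x : yc ≡ x
  yc≡x = coprime-∣*+1⇒≡ c⊥nB c∣nByc+1 c∣nBx+1 yc≤x x<c

termsSum-subsum : ∀ n c L ys yc y → .{{NonZero n}} → .{{NonZero c}} →
  All NonZero L → length ys ≡ length L →
  termsSum (zip (ys ++ yc ∷ y ∷ []) (L ++ c ∷ n * product L * c ∷ [])) ≡
  frac (ℤ.+ (product L * c * subsumNumerator n c L ys yc y)) (product L * c * (n * (product L * c)))
termsSum-subsum n c L ys yc y L≢0 |ys|≡ = begin
  termsSum (zip (ys ++ yc ∷ y ∷ []) (L ++ c ∷ D ∷ []))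
    ≡⟨ cong termsSum (zip-++ ys L |ys|≡) ⟩
  termsSum (zip ys L ++ (yc , c) ∷ (y , D) ∷ [])
    ≡⟨ termsSum-++ (zip ys L) _ ⟩
  termsSum (zip ys L) ℚ.+ (frac (ℤ.+ yc) c ℚ.+ (frac (ℤ.+ y) D ℚ.+ 0ℚ))
    ≡⟨ cong₂ (λ u v → u ℚ.+ (frac (ℤ.+ yc) c ℚ.+ v))
             (termsSum-zip ys L |ys|≡ L≢0) (ℚ.+-identityʳ _) ⟩
  frac (ℤ.+ w) B ℚ.+ (frac (ℤ.+ yc) c ℚ.+ frac (ℤ.+ y) D)
    ≡⟨ cong (frac (ℤ.+ w) B ℚ.+_) (frac-+ yc y c D {{it}} {{D≢0}}) ⟩
  frac (ℤ.+ w) B ℚ.+ frac (ℤ.+ (yc * D + y * c)) (c * D)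
    ≡⟨ frac-+ w _ B (c * D) {{B≢0}} {{m*n≢0 c D {{it}} {{D≢0}}}} ⟩
  frac (ℤ.+ (w * (c * D) + (yc * D + y * c) * B)) (B * (c * D))
    ≡⟨ cong₂ (λ u v → frac (ℤ.+ u) v) (numerator w c B n yc y) (denominator B c n) ⟩
  frac (ℤ.+ (B * c * subsumNumerator n c L ys yc y)) (B * c * (n * (B * c))) ∎
  where
  open ≡-Reasoning
  B = product L
  D = n * B * c
  w = weightedNumerator ys L
  B≢0 : NonZero B
  B≢0 = product≢0 L≢0
  D≢0 : NonZero D
  D≢0 = m*n≢0 (n * B) c {{m*n≢0 n B {{it}} {{B≢0}}}}
  numerator : ∀ w c B n yc y → w * (c * (n * B * c)) + (yc * (n * B * c) + y * c) * B ≡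
                               B * c * (n * (w * c + yc * B) + y)
  numerator = solve-∀
  denominator : ∀ B c n → B * (c * (n * B * c)) ≡ B * c * (n * (B * c))
  denominator = solve-∀

frac-*-cancel : ∀ P a n → .{{NonZero P}} → .{{NonZero n}} →
  frac (ℤ.+ (P * (a * P))) (P * (n * P)) ≡ frac (ℤ.+ a) n
frac-*-cancel P a n = frac-≡ {{m*n≢0 P (n * P) {{it}} {{m*n≢0 n P}}}} (lemma P a n)
  where
  lemma : ∀ P a n → P * (a * P) * n ≡ a * (P * (n * P))
  lemma = solve-∀

frac-*≡frac⇒∣ : ∀ P V n {z} → .{{NonZero P}} → .{{NonZero n}} →
  frac (ℤ.+ (P * V)) (P * (n * P)) ≡ frac z n → P ∣ V
frac-*≡frac⇒∣ P V n eq =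
  *-cancelˡ-∣ n (*-cancelˡ-∣ P (subst (P * (n * P) ∣_) (lemma P V n)
    (frac≡frac⇒∣ {{m*n≢0 P (n * P) {{it}} {{m*n≢0 n P}}}} eq)))
  where
  lemma : ∀ P V n → P * V * n ≡ P * (n * V)
  lemma = solve-∀

unitTerms : List ℕ → List (ℕ × ℕ)
unitTerms = map (λ b → (1 , b))

unitTerms≡zip : ∀ L → unitTerms L ≡ zip (ones L) L
unitTerms≡zip []      = refl
unitTerms≡zip (b ∷ L) = cong ((1 , b) ∷_) (unitTerms≡zip L)

map-proj₁-unitTerms : ∀ L → map proj₁ (unitTerms L) ≡ ones L
map-proj₁-unitTerms L = sym (map-∘ L)

map-proj₂-unitTerms : ∀ L → map proj₂ (unitTerms L) ≡ L
map-proj₂-unitTerms L = trans (sym (map-∘ L)) (map-id L)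

snoc-distinct : ∀ {xs D} → AllPairs _≢_ xs → All (_< D) xs → AllPairs _≢_ (xs ++ D ∷ [])
snoc-distinct xs≢ xs<D = AllPairsP.++⁺ xs≢ ([] ∷ []) (All.map (λ x<D → <⇒≢ x<D ∷ []) xs<D)

pairwiseCoprime⇒distinct : ∀ {xs} → All (2 ≤_) xs → AllPairs Coprime xs → AllPairs _≢_ xs
pairwiseCoprime⇒distinct []             []            = []
pairwiseCoprime⇒distinct (x≥2 ∷ xs≥2) (x⊥xs ∷ xs⊥) =
  All.map (coprime-≥2⇒≢ x≥2) x⊥xs ∷ pairwiseCoprime⇒distinct xs≥2 xs⊥

module _ {m n x c t} {bs : Vec ℕ t} (e : Expansion m n (toList bs) x c) where

  open Expansion e
  open CoprimeDenominators denominators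

  private
    L = toList bs
    B = product L
    D = n * B * c
    rest : List (ℕ × ℕ)
    rest = (x , c) ∷ (1 , D) ∷ []

  instance
    n≢0 : NonZero n
    n≢0 = m*n≢0⇒m≢0 n {{≥2⇒nonZero 2≤nB}}
    c≢0 : NonZero c
    c≢0 = ≥2⇒nonZero (≤-trans (s≤s 1≤x) x<c)
    B≢0 : NonZero B
    B≢0 = product-nonZero all≥2
    nB≢0 : NonZero (n * B)
    nB≢0 = ≥2⇒nonZero 2≤nB
    Bc≢0 : NonZero (B * c)
    Bc≢0 = m*n≢0 B c

  L≢0 : All NonZero L
  L≢0 = All.map ≥2⇒nonZero all≥2

  expansion-pairwiseCoprime : AllPairs Coprime (L ++ c ∷ [])
  expansion-pairwiseCoprime =
    AllPairsP.++⁺ pairwiseCoprime ([] ∷ [])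
                  (All.map (λ b⊥nc → coprime-∣ʳ (n∣m*n n) b⊥nc ∷ []) coprimeTo)

  expansion-≥2 : All (2 ≤_) (L ++ c ∷ [])
  expansion-≥2 = AllP.++⁺ all≥2 (≤-trans (s≤s 1≤x) x<c ∷ [])

  map-proj₂-expansionTerms : map proj₂ (choiceTerms n (t , x , bs , c)) ≡ L ++ c ∷ D ∷ []
  map-proj₂-expansionTerms =
    trans (map-++ proj₂ (unitTerms L) rest) (cong (_++ c ∷ D ∷ []) (map-proj₂-unitTerms L))

  expansionTerms-distinct : AllPairs _≢_ (map proj₂ (choiceTerms n (t , x , bs , c)))
  expansionTerms-distinct =
    subst (AllPairs _≢_) (trans (++-assoc L (c ∷ []) (D ∷ [])) (sym map-proj₂-expansionTerms))
      (snoc-distinct (pairwiseCoprime⇒distinct expansion-≥2 expansion-pairwiseCoprime)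
                     (AllP.++⁺ (All.tabulate (λ b∈L → ≤-<-trans (∈⇒≤product L≢0 b∈L) B<D))
                               (c<D ∷ [])))
    where
    B<D : B < D
    B<D = ≤-<-trans (m≤n*m B n) (m<m*n (n * B) c (≤-trans (s≤s 1≤x) x<c))
    c<D : c < D
    c<D = subst (_< D) (*-identityˡ c) (*-monoˡ-< c 2≤nB)

  expansionTerms-positive : All (λ p → 0 < proj₁ p × 0 < proj₂ p) (choiceTerms n (t , x , bs , c))
  expansionTerms-positive =
    AllP.++⁺ (AllP.map⁺ (All.map (λ b≥2 → z<s , ≤-trans (s≤s z≤n) b≥2) all≥2))
             ((1≤x , >-nonZero⁻¹ c) ∷ (z<s , >-nonZero⁻¹ D {{m*n≢0 (n * B) c}}) ∷ [])

  map-proj₁-expansionTerms : map proj₁ (choiceTerms n (t , x , bs , c)) ≡ ones L ++ x ∷ 1 ∷ []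
  map-proj₁-expansionTerms =
    trans (map-++ proj₁ (unitTerms L) rest) (cong (_++ x ∷ 1 ∷ []) (map-proj₁-unitTerms L))

  subsum : List ℕ → ℕ → ℕ → ℚ
  subsum ys yc y = termsSum (zip (ys ++ yc ∷ y ∷ []) (map proj₂ (choiceTerms n (t , x , bs , c))))

  subsum-value : ∀ ys yc y → length ys ≡ length L →
    subsum ys yc y ≡ frac (ℤ.+ (B * c * subsumNumerator n c L ys yc y)) (B * c * (n * (B * c)))
  subsum-value ys yc y |ys|≡ =
    trans (cong (termsSum ∘ zip (ys ++ yc ∷ y ∷ [])) map-proj₂-expansionTerms)
          (termsSum-subsum n c L ys yc y L≢0 |ys|≡)

  expansionTerms-sum : termsSum (choiceTerms n (t , x , bs , c)) ≡ frac (ℤ.+ m) n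
  expansionTerms-sum = begin
    termsSum (unitTerms L ++ rest)
      ≡⟨ cong (λ u → termsSum (u ++ rest)) (unitTerms≡zip L) ⟩
    termsSum (zip (ones L) L ++ rest)
      ≡⟨ cong termsSum (zip-++ (ones L) L (length-map _ L)) ⟨
    termsSum (zip (ones L ++ x ∷ 1 ∷ []) (L ++ c ∷ D ∷ []))
      ≡⟨ termsSum-subsum n c L (ones L) x 1 L≢0 (length-map _ L) ⟩
    frac (ℤ.+ (B * c * subsumNumerator n c L (ones L) x 1)) (B * c * (n * (B * c)))
      ≡⟨ cong (λ v → frac (ℤ.+ (B * c * v)) (B * c * (n * (B * c)))) identity ⟩
    frac (ℤ.+ (B * c * (m * (B * c)))) (B * c * (n * (B * c)))
      ≡⟨ frac-*-cancel (B * c) m n ⟩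
    frac (ℤ.+ m) n ∎
    where open ≡-Reasoning

  subsum-faithful : ∀ ys yc y → Pointwise _≤_ ys (ones L) → yc ≤ x → y ≤ 1 →
    (∃ λ z → subsum ys yc y ≡ frac z n) → subsum ys yc y ≡ frac (ℤ.+ m) n ⊎ subsum ys yc y ≡ 0ℚ
  subsum-faithful ys yc y ys≤1 yc≤x y≤1 (z , v≡z/n) =
    Sum.swap (Sum.map zero-value total-value
      (expansion-∣subsumNumerator e ys≤1 yc≤x y≤1 (frac-*≡frac⇒∣ P V n (trans (sym value) v≡z/n))))
    where
    P = B * c
    V = subsumNumerator n c L ys yc y
    instance
      _ : NonZero (P * (n * P))
      _ = m*n≢0 P (n * P) {{it}} {{m*n≢0 n P}}
    value : subsum ys yc y ≡ frac (ℤ.+ (P * V)) (P * (n * P))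
    value = subsum-value ys yc y (trans (Pointwise-length ys≤1) (length-map _ L))
    zero-value : V ≡ 0 → subsum ys yc y ≡ 0ℚ
    zero-value V≡0 = trans value (trans (cong (λ u → frac (ℤ.+ u) (P * (n * P)))
                                              (trans (cong (P *_) V≡0) (*-zeroʳ P)))
                                        (frac-0 _))
    total-value : V ≡ m * P → subsum ys yc y ≡ frac (ℤ.+ m) n
    total-value V≡mP = trans value (trans (cong (λ v → frac (ℤ.+ (P * v)) (P * (n * P))) V≡mP)
                                          (frac-*-cancel P m n))

  expansion-faithful : IsFaithful m n (choiceTerms n (t , x , bs , c))
  expansion-faithful = (expansionTerms-positive , expansionTerms-distinct , expansionTerms-sum) , faithful
    where
    faithful : ∀ xs → Pointwise _≤_ xs (map proj₁ (choiceTerms n (t , x , bs , c))) →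
      let v = termsSum (zip xs (map proj₂ (choiceTerms n (t , x , bs , c)))) in
      (∃ λ z → v ≡ frac z n) → v ≡ frac (ℤ.+ m) n ⊎ v ≡ 0ℚ
    faithful xs xs≤
      with ys , _ , refl , ys≤1 , yc≤x ∷ y≤1 ∷ [] ←
             Pointwise-++⁻ (ones L) _ (subst (Pointwise _≤_ xs) map-proj₁-expansionTerms xs≤)
      = subsum-faithful ys _ _ ys≤1 yc≤x y≤1

-- Valid choices

All-lookup : ∀ {P : ℕ → Set} {t} (v : Vec ℕ t) → All P (toList v) → ∀ i → P (lookup v i)
All-lookup (x ∷ v) (px ∷ _)  zero    = px
All-lookup (x ∷ v) (_ ∷ pv) (suc i) = All-lookup v pv i

AllPairs-lookup : ∀ {R : ℕ → ℕ → Set} → (∀ {a b} → R a b → R b a) → ∀ {t} (v : Vec ℕ t) →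
  AllPairs R (toList v) → ∀ i j → i ≢ j → R (lookup v i) (lookup v j)
AllPairs-lookup sym-R (x ∷ v) _          zero    zero    i≢j = ⊥-elim (i≢j refl)
AllPairs-lookup sym-R (x ∷ v) (Rx ∷ _)   zero    (suc j) _   = All-lookup v Rx j
AllPairs-lookup sym-R (x ∷ v) (Rx ∷ _)   (suc i) zero    _   = sym-R (All-lookup v Rx i)
AllPairs-lookup sym-R (x ∷ v) (_ ∷ Rv)   (suc i) (suc j) i≢j =
  AllPairs-lookup sym-R v Rv i j (i≢j ∘ cong suc)

expansion⇒validChoice : ∀ {m n x c t Ω} {bs : Vec ℕ t} → Expansion m n (toList bs) x c →
  All (λ b → Coprime b (product Ω)) (toList bs ++ c ∷ []) → ValidChoice m n Ω (t , x , bs , c)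
expansion⇒validChoice {c = c} {bs = bs} e b⊥Ω =
  All-lookup (bs ∷ʳ c) (onAllB (All.map (≤-trans (s≤s z≤n)) (expansion-≥2 e))) ,
  expansion-faithful e ,
  AllPairs-lookup coprime-sym (bs ∷ʳ c)
    (subst (AllPairs Coprime) (sym (toList-∷ʳ c bs)) (expansion-pairwiseCoprime e)) ,
  λ i ω ω∈Ω → coprime-∣ʳ (∈⇒∣product ω∈Ω) (All-lookup (bs ∷ʳ c) (onAllB b⊥Ω) i)
  where
  onAllB : ∀ {P : ℕ → Set} → All P (toList bs ++ c ∷ []) → All P (toList (bs ∷ʳ c))
  onAllB {P} = subst (All P) (sym (toList-∷ʳ c bs))

expansion⇒validChoice-fromList : ∀ {m n x c Ω} L → Expansion m n L x c →
  All (λ b → Coprime b (product Ω)) (L ++ c ∷ []) → ValidChoice m n Ω (length L , x , fromList L , c)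
expansion⇒validChoice-fromList {m} {n} {x} {c} {Ω} L e L⊥Ω =
  expansion⇒validChoice (subst (λ L′ → Expansion m n L′ x c) L≡ e)
                        (subst (λ L′ → All (λ b → Coprime b (product Ω)) (L′ ++ c ∷ [])) L≡ L⊥Ω)
  where
  L≡ : L ≡ toList (fromList L)
  L≡ = sym (toList∘fromList L)

lastDenominator : Choice → ℕ
lastDenominator (_ , _ , _ , c) = c

validChoice-unbounded : ∀ m n Ω → .{{NonZero n}} → .{{NonZero (product Ω)}} → 1 ≤ m → Coprime m n →
  ∀ β → ∃ λ τ → ValidChoice m n Ω τ × β < lastDenominator τ
validChoice-unbounded m n Ω 1≤m m⊥n β =
  let W = product Ω
      bs , bs-ok , mB≤nR = reciprocalSum-exceeding m n (n * W) {{it}} {{m*n≢0 n W}}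
      ds , ds-ok , M , mB≡ , 1≤M , M<nB = straddlingTail m n (n * W) bs 1≤m bs-ok mB≤nR
      ds-ok′ = coprimeDenominators-∣ (m∣m*n W) ds-ok
      c , x , Mc≡ , β<c , c⊥W =
        largeInverse W (suc β) (≤-<-trans 1≤M M<nB) (remainder-coprime m⊥n ds-ok′ mB≡)
      e = remainderExpansion ds-ok′ mB≡ 1≤M M<nB Mc≡ (≤-trans (s≤s (s≤s z≤n)) β<c)
      ds++c⊥W = AllP.++⁺ (All.map (coprime-∣ʳ (n∣m*n n)) (CoprimeDenominators.coprimeTo ds-ok))
                         (c⊥W ∷ [])
  in  (length ds , x , fromList ds , c) , expansion⇒validChoice-fromList ds e ds++c⊥W , <-trans (n<1+n β) β<c

theorem1p2 : (m n : ℕ) → 0 < m → 0 < n → Coprime m n →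
    (Ω : List ℕ) → All (0 <_) Ω →
    (L : List Choice) → ∃ λ (τ : Choice) → ValidChoice m n Ω τ × τ ∉ L
theorem1p2 m n 0<m 0<n m⊥n Ω Ω>0 L =
  let bound = sum (map lastDenominator L)
      τ , τ-valid , bound<c = validChoice-unbounded m n Ω {{>-nonZero 0<n}}
                                {{product≢0 (All.map >-nonZero Ω>0)}} 0<m m⊥n bound
  in  τ , τ-valid , λ τ∈L → <⇒≱ bound<c (∈⇒≤sum-map lastDenominator τ∈L)
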